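{- The graph $G_{12}$ is weakly CIS.
   Context: $G_{12}$ is the graph on vertex set $\{1,\dots,12\}$ in which two distinct vertices are adjacent iff they lie together in some member of the family $\mathcal C=\{\{1,4,7\},\{2,4,5,6\},\{2,4,6,7\},\{2,4,6,9\},\{2,4,9,12\},\{2,5,8\},\{2,6,7,11\},\{2,11,12\},\{3,6,9\},\{4,5,6,10\},\{4,10,12\},\{6,10,11\},\{10,11,12\}\}$. ($\mathcal C$ is the family of all maximal cliques of $G_{12}$, and the family of all maximal stable sets is $\{\{1,2,3,10\},\{1,3,5,11\},\{1,3,5,12\},\{1,3,8,10\},\{1,3,8,11\},\{1,3,8,12\},\{1,5,9,11\},\{1,6,8,12\},\{1,8,9,10\},\{1,8,9,11\},\{3,4,8,11\},\{3,5,7,12\},\{3,7,8,10\},\{3,7,8,12\},\{5,7,9\},\{7,8,9,10\}\}$.) A family of maximal cliques is edge covering if every two adjacent vertices lie together in some member; a family of maximal stable sets is non-edge covering if every two distinct non-adjacent vertices lie together in some member. A graph is weakly CIS if there exist an edge covering family $\mathcal C'$ of maximal cliques and a non-edge covering family $\mathcal S'$ of maximal stable sets with $C\cap S\neq\emptyset$ for all $C\in\mathcal C'$, $S\in\mathcal S'$. -}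

module Defs where

open import Data.Nat using (ℕ; suc)
open import Data.Fin using (Fin; toℕ)
open import Data.Fin.Subset using (Subset; _∈_; _∉_; _⊆_; _∩_; Nonempty)
open import Data.List using (List; []; _∷_)
open import Data.List.Relation.Unary.All using (All)
open import Data.List.Relation.Unary.Any using (Any)
open import Data.Product using (_×_; Σ-syntax)
open import Relation.Binary.PropositionalEquality using (_≢_)
open import Relation.Nullary using (¬_)
import Data.List.Membership.Propositional as L

module _ {n : ℕ} (Adj : Fin n → Fin n → Set) where

  IsClique : Subset n → Set
  IsClique S = ∀ u v → u ∈ S → v ∈ S → u ≢ v → Adj u v

  IsStable : Subset n → Set
  IsStable S = ∀ u v → u ∈ S → v ∈ S → u ≢ v → ¬ Adj u v

  IsMaximalClique : Subset n → Set
  IsMaximalClique S = IsClique S × (∀ K → IsClique K → S ⊆ K → K ⊆ S)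

  IsMaximalStable : Subset n → Set
  IsMaximalStable S = IsStable S × (∀ K → IsStable K → S ⊆ K → K ⊆ S)

  EdgeCovering : List (Subset n) → Set
  EdgeCovering F = ∀ u v → u ≢ v → Adj u v → Any (λ C → u ∈ C × v ∈ C) F

  NonEdgeCovering : List (Subset n) → Set
  NonEdgeCovering F = ∀ u v → u ≢ v → ¬ Adj u v → Any (λ S → u ∈ S × v ∈ S) F

  WeaklyCIS : Set
  WeaklyCIS =
    Σ[ C′ ∈ List (Subset n) ] Σ[ S′ ∈ List (Subset n) ]
      ( All IsMaximalClique C′ × EdgeCovering C′
      × All IsMaximalStable S′ × NonEdgeCovering S′
      × All (λ C → All (λ S → Nonempty (C ∩ S)) S′) C′ )

-- The graph G₁₂. Vertex i : Fin 12 stands for the label toℕ i + 1 ∈ {1,…,12}.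
label : Fin 12 → ℕ
label i = suc (toℕ i)

𝒞 : List (List ℕ)
𝒞 = (1 ∷ 4 ∷ 7 ∷ [])
  ∷ (2 ∷ 4 ∷ 5 ∷ 6 ∷ [])
  ∷ (2 ∷ 4 ∷ 6 ∷ 7 ∷ [])
  ∷ (2 ∷ 4 ∷ 6 ∷ 9 ∷ [])
  ∷ (2 ∷ 4 ∷ 9 ∷ 12 ∷ [])
  ∷ (2 ∷ 5 ∷ 8 ∷ [])
  ∷ (2 ∷ 6 ∷ 7 ∷ 11 ∷ [])
  ∷ (2 ∷ 11 ∷ 12 ∷ [])
  ∷ (3 ∷ 6 ∷ 9 ∷ [])
  ∷ (4 ∷ 5 ∷ 6 ∷ 10 ∷ [])
  ∷ (4 ∷ 10 ∷ 12 ∷ [])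
  ∷ (6 ∷ 10 ∷ 11 ∷ [])
  ∷ (10 ∷ 11 ∷ 12 ∷ [])
  ∷ []

G₁₂-Adj : Fin 12 → Fin 12 → Set
G₁₂-Adj u v = u ≢ v × Any (λ C → label u L.∈ C × label v L.∈ C) 𝒞

module Submission where

-- Being weakly CIS is witnessed by two explicit families, so the
-- proof consists of exhibiting them and checking five finite conditions.
--
-- The only condition
-- that is not a bounded quantification over vertices is maximality, which
-- quantifies over all supersets; it is replaced by the local criterion
-- "every vertex outside S has a distinct non-neighbour (resp. neighbour) in S",
-- which is decidable and implies maximality.

open import Defs
open import Data.Nat using (ℕ; _≟_)
open import Data.Bool using (if_then_else_)
open import Data.Fin using (Fin)
import Data.Fin as Fin
open import Data.Fin.Properties using (all?; any?)
open import Data.Fin.Subset using (Subset; _∈_; _∉_; _∩_; Nonempty; inside; outside)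
open import Data.Fin.Subset.Properties using (_∈?_; nonempty?)
open import Data.Vec using (tabulate)
open import Data.List using (List; []; _∷_)
open import Data.List.Relation.Unary.All as All using (All)
import Data.List.Relation.Unary.Any as Any
open import Data.List.Membership.DecPropositional _≟_ using () renaming (_∈?_ to _∈ℕ?_)
open import Data.Product using (_×_; _,_; ∃)
open import Relation.Binary.Definitions using (Decidable)
open import Relation.Binary.PropositionalEquality using (_≢_)
open import Relation.Nullary using (¬_; Dec; does)
open import Relation.Nullary.Decidable using (_×-dec_; _→-dec_; ¬?; toWitness; decidable-stable)

module DecidableGraph {n : ℕ} {Adj : Fin n → Fin n → Set} (adj? : Decidable Adj) where

  isClique? : ∀ S → Dec (IsClique Adj S)
  isClique? S = all? λ u → all? λ v →
    (u ∈? S) →-dec (v ∈? S) →-dec ¬? (u Fin.≟ v) →-dec adj? u v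

  isStable? : ∀ S → Dec (IsStable Adj S)
  isStable? S = all? λ u → all? λ v →
    (u ∈? S) →-dec (v ∈? S) →-dec ¬? (u Fin.≟ v) →-dec ¬? (adj? u v)

  CliqueBlocked : Subset n → Set
  CliqueBlocked S = ∀ x → x ∉ S → ∃ λ y → y ∈ S × x ≢ y × ¬ Adj x y

  StableBlocked : Subset n → Set
  StableBlocked S = ∀ x → x ∉ S → ∃ λ y → y ∈ S × x ≢ y × Adj x y

  cliqueBlocked? : ∀ S → Dec (CliqueBlocked S)
  cliqueBlocked? S = all? λ x → ¬? (x ∈? S) →-dec any? λ y →
    (y ∈? S) ×-dec ¬? (x Fin.≟ y) ×-dec ¬? (adj? x y)

  stableBlocked? : ∀ S → Dec (StableBlocked S)
  stableBlocked? S = all? λ x → ¬? (x ∈? S) →-dec any? λ y →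
    (y ∈? S) ×-dec ¬? (x Fin.≟ y) ×-dec adj? x y

  -- A blocked clique is maximal: a vertex x of a larger clique K cannot lie
  -- outside S, since its blocking non-neighbour y ∈ S ⊆ K would be adjacent
  -- to x.  Membership is decidable, so refuting x ∉ S gives x ∈ S.
  blocked⇒maximalClique : ∀ S → IsClique Adj S × CliqueBlocked S → IsMaximalClique Adj S
  blocked⇒maximalClique S (clique , blocked) = clique , λ K cliqueK S⊆K {x} x∈K →
    decidable-stable (x ∈? S) λ x∉S →
      let (y , y∈S , x≢y , ¬xy) = blocked x x∉S
      in ¬xy (cliqueK x y x∈K (S⊆K y∈S) x≢y)

  blocked⇒maximalStable : ∀ S → IsStable Adj S × StableBlocked S → IsMaximalStable Adj S
  blocked⇒maximalStable S (stable , blocked) = stable , λ K stableK S⊆K {x} x∈K →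
    decidable-stable (x ∈? S) λ x∉S →
      let (y , y∈S , x≢y , xy) = blocked x x∉S
      in stableK x y x∈K (S⊆K y∈S) x≢y xy

  allMaximalCliques : ∀ F → All (λ S → IsClique Adj S × CliqueBlocked S) F → All (IsMaximalClique Adj) F
  allMaximalCliques F = All.map (λ {S} → blocked⇒maximalClique S)

  allMaximalStable : ∀ F → All (λ S → IsStable Adj S × StableBlocked S) F → All (IsMaximalStable Adj) F
  allMaximalStable F = All.map (λ {S} → blocked⇒maximalStable S)

  coveredBy? : ∀ F (u v : Fin n) → Dec (Any.Any (λ C → u ∈ C × v ∈ C) F)
  coveredBy? F u v = Any.any? (λ C → (u ∈? C) ×-dec (v ∈? C)) F

  edgeCovering? : ∀ F → Dec (EdgeCovering Adj F)
  edgeCovering? F = all? λ u → all? λ v →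
    ¬? (u Fin.≟ v) →-dec adj? u v →-dec coveredBy? F u v

  nonEdgeCovering? : ∀ F → Dec (NonEdgeCovering Adj F)
  nonEdgeCovering? F = all? λ u → all? λ v →
    ¬? (u Fin.≟ v) →-dec ¬? (adj? u v) →-dec coveredBy? F u v

  crossIntersecting? : (F G : List (Subset n)) → Dec (All (λ C → All (λ S → Nonempty (C ∩ S)) G) F)
  crossIntersecting? F G = All.all? (λ C → All.all? (λ S → nonempty? (C ∩ S)) G) F

G₁₂-adj? : Decidable G₁₂-Adj
G₁₂-adj? u v = ¬? (u Fin.≟ v) ×-dec Any.any? (λ C → (label u ∈ℕ? C) ×-dec (label v ∈ℕ? C)) 𝒞

labelled : List ℕ → Subset 12
labelled ls = tabulate λ i → if does (label i ∈ℕ? ls) then inside else outside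

𝒞′ : List (Subset 12)
𝒞′ = labelled (1 ∷ 4 ∷ 7 ∷ [])
   ∷ labelled (2 ∷ 4 ∷ 9 ∷ 12 ∷ [])
   ∷ labelled (2 ∷ 5 ∷ 8 ∷ [])
   ∷ labelled (2 ∷ 6 ∷ 7 ∷ 11 ∷ [])
   ∷ labelled (3 ∷ 6 ∷ 9 ∷ [])
   ∷ labelled (4 ∷ 5 ∷ 6 ∷ 10 ∷ [])
   ∷ labelled (10 ∷ 11 ∷ 12 ∷ [])
   ∷ []

𝒮′ : List (Subset 12)
𝒮′ = labelled (1 ∷ 2 ∷ 3 ∷ 10 ∷ [])
   ∷ labelled (1 ∷ 5 ∷ 9 ∷ 11 ∷ [])
   ∷ labelled (1 ∷ 6 ∷ 8 ∷ 12 ∷ [])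
   ∷ labelled (3 ∷ 4 ∷ 8 ∷ 11 ∷ [])
   ∷ labelled (3 ∷ 5 ∷ 7 ∷ 12 ∷ [])
   ∷ labelled (7 ∷ 8 ∷ 9 ∷ 10 ∷ [])
   ∷ []

open DecidableGraph G₁₂-adj?

proposition34 : WeaklyCIS G₁₂-Adj
proposition34 = 𝒞′ , 𝒮′
  , allMaximalCliques 𝒞′ (toWitness {a? = All.all? (λ S → isClique? S ×-dec cliqueBlocked? S) 𝒞′} _)
  , toWitness {a? = edgeCovering? 𝒞′} _
  , allMaximalStable 𝒮′ (toWitness {a? = All.all? (λ S → isStable? S ×-dec stableBlocked? S) 𝒮′} _)
  , toWitness {a? = nonEdgeCovering? 𝒮′} _
  , toWitness {a? = crossIntersecting? 𝒞′ 𝒮′} _
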